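{- For every typing context $\Gamma$, computations $M,N$, store terms $s,t$ and computation type $\kappa$: if $\Gamma\vdash(M,s):\kappa$ and $(M,s)\to(N,t)$, then $\Gamma\vdash(N,t):\kappa$.
   Context: Syntax. Fix a countably infinite set $\mathbf{L}$ of locations and a countable set of variables. Values $V,W,U ::= x \mid \lambda x.M$; computations $M,N ::= [V] \mid M \star V \mid \mathit{get}_\ell(\lambda x.M) \mid \mathit{set}_\ell(V,M)$ ($\ell\in\mathbf{L}$); $x$ is bound in $\lambda x.M$ and $\mathit{get}_\ell(\lambda x.M)$, terms are taken up to renaming of bound variables, $M[V/x]$ is capture-avoiding substitution. Stores. Store terms $s,t ::= \mathrm{emp} \mid \mathrm{upd}_\ell(u,s)$, lookup terms $u ::= V \mid \mathrm{lkp}_\ell(s)$ with $\mathrm{lkp}_\ell(s)$ allowed only when $\ell\in\mathrm{dom}(s)$; $\mathrm{dom}(\mathrm{emp})=\emptyset$, $\mathrm{dom}(\mathrm{upd}_\ell(u,s))=\{\ell\}\cup\mathrm{dom}(s)$. $\vdash a=b$ means derivable in equational logic from: $\mathrm{lkp}_\ell(\mathrm{upd}_\ell(u,s))=u$; $\mathrm{lkp}_\ell(\mathrm{upd}_{\ell'}(u,s))=\mathrm{lkp}_\ell(s)$ ($\ell\ne\ell'$); $\mathrm{upd}_\ell(\mathrm{lkp}_\ell(s),s)=s$; $\mathrm{upd}_\ell(U,\mathrm{upd}_\ell(W,s))=\mathrm{upd}_\ell(U,s)$; $\mathrm{upd}_\ell(U,\mathrm{upd}_{\ell'}(W,s))=\mathrm{upd}_{\ell'}(W,\mathrm{upd}_\ell(U,s))$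 ($\ell\neq\ell'$). Reduction on configurations $(M,s)$: $([V]\star\lambda x.M,s)\to(M[V/x],s)$; if $(M,s)\to(N,t)$ then $(M\star V,s)\to(N\star V,t)$; if $\vdash\mathrm{lkp}_\ell(s)=V$ with $V$ a value then $(\mathit{get}_\ell(\lambda x.M),s)\to(M[V/x],s)$; $(\mathit{set}_\ell(V,M),s)\to(M,\mathrm{upd}_\ell(V,s))$. Types. Value types $\delta ::= \delta\to\tau \mid \delta\wedge\delta \mid \omega_D$; store types $\sigma ::= \langle \ell:\delta\rangle \mid \sigma\wedge\sigma \mid \omega_S$; computation types $\kappa ::= \delta\times\sigma \mid \kappa\wedge\kappa\mid\omega_C$; configuration types $\tau ::= \sigma\to\kappa \mid \tau\wedge\tau \mid \omega_T$. For each sort $A$, $\le_A$ is the least preorder with $\varphi\le\omega_A$, $\varphi\wedge\psi\le\varphi$, $\varphi\wedge\psi\le\psi$, $\varphi\le\varphi\wedge\varphi$, monotonicity of $\wedge$, and: $\omega_D\le\omega_D\to\omega_T$; $(\delta\to\tau)\wedge(\delta\to\tau')\le\delta\to(\tau\wedge\tau')$; $\langle\ell:\delta\rangle\wedge\langle\ell:\delta'\rangle\le\langle\ell:\delta\wedge\delta'\rangle$; $\omega_C\le\omega_D\times\omega_S$; $(\delta\times\sigma)\wedge(\delta'\times\sigma')\le(\delta\wedge\delta')\times(\sigma\wedge\sigma')$; $\omega_T\le\omega_S\to\omega_C$; $(\sigma\to\kappa)\wedge(\sigma\to\kappa')\le\sigma\to(\kappa\wedge\kappa')$; arrows contravariant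 in argument, covariant in result; $\times$ and $\langle\ell:\cdot\rangle$ covariant. $\mathrm{dom}(\langle\ell:\delta\rangle)=\{\ell\}$, $\mathrm{dom}(\sigma\wedge\sigma')=\mathrm{dom}(\sigma)\cup\mathrm{dom}(\sigma')$, $\mathrm{dom}(\omega_S)=\emptyset$. Type system. Contexts $\Gamma$ are finite maps from variables to value types ($\Gamma,x:\delta$ requires $x\notin\mathrm{dom}(\Gamma)$). Rules: $\Gamma\vdash Q:\omega_A$ for $Q$ of the corresponding sort (values and lookup terms: $D$; stores: $S$; computations: $T$; configurations: $C$); intersection introduction; subsumption along $\le$; $\Gamma,x:\delta\vdash x:\delta$; $\Gamma,x:\delta\vdash M:\tau\Rightarrow\Gamma\vdash\lambda x.M:\delta\to\tau$; $\Gamma\vdash V:\delta\Rightarrow\Gamma\vdash[V]:\sigma\to\delta\times\sigma$; $\Gamma\vdash M:\sigma\to\delta'\times\sigma'$ and $\Gamma\vdash V:\delta'\to\sigma'\to\delta''\times\sigma''$ $\Rightarrow\Gamma\vdash M\star V:\sigma\to\delta''\times\sigma''$; $\Gamma,x:\delta\vdash M:\sigma\to\kappa\Rightarrow\Gamma\vdash\mathit{get}_\ell(\lambda x.M):(\langle\ell:\delta\rangle\wedge\sigma)\to\kappa$; $\Gamma\vdash V:\delta$, $\Gamma\vdash M:(\langle\ell:\delta\rangle\wedge\sigma)\to\kappa$, $\ell\notin\mathrm{dom}(\sigma)$ $\Rightarrow\Gamma\vdash\mathit{set}_\ell(V,M):\sigma\to\kappa$; $\Gamma\vdash V:\delta\Rightarrow\Gamma\vdash\mathrm{upd}_\ell(V,s):\langle\ell:\delta\rangle$;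 $\Gamma\vdash s:\langle\ell':\delta\rangle$, $\ell\ne\ell'$ $\Rightarrow\Gamma\vdash\mathrm{upd}_\ell(V,s):\langle\ell':\delta\rangle$; $\Gamma\vdash s:\langle\ell:\delta\rangle\Rightarrow\Gamma\vdash\mathrm{lkp}_\ell(s):\delta$; $\Gamma\vdash M:\sigma\to\kappa$, $\Gamma\vdash s:\sigma$ $\Rightarrow\Gamma\vdash(M,s):\kappa$. -}

module Defs where

open import Data.Nat using (ℕ; zero; suc; _≡ᵇ_)
open import Data.Bool using (Bool; true; false; _∨_; T)
open import Data.List using (List; []; _∷_)
open import Relation.Binary.PropositionalEquality using (_≡_)
open import Relation.Nullary using (¬_)

-- Locations and variables (countably infinite): natural numbers.
-- Terms use de Bruijn indices (terms up to renaming of bound variables).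

Loc : Set
Loc = ℕ

Var : Set
Var = ℕ

-- Syntax
--   V ::= x | λx.M
--   M ::= [V] | M ⋆ V | get_ℓ(λx.M) | set_ℓ(V,M)
-- 'get ℓ M' represents get_ℓ(λx.M): M lives under one binder.

data Val : Set
data Comp : Set

data Val where
  var : Var → Val
  lam : Comp → Val

data Comp where
  ret : Val → Comp
  _⋆_ : Comp → Val → Comp
  get : Loc → Comp → Comp
  set : Loc → Val → Comp → Comp

ext : (Var → Var) → Var → Var
ext ρ zero = zero
ext ρ (suc n) = suc (ρ n)

renV : (Var → Var) → Val → Val
renC : (Var → Var) → Comp → Comp
renV ρ (var x) = var (ρ x)
renV ρ (lam M) = lam (renC (ext ρ) M)
renC ρ (ret V) = ret (renV ρ V)
renC ρ (M ⋆ V) = renC ρ M ⋆ renV ρ V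
renC ρ (get ℓ M) = get ℓ (renC (ext ρ) M)
renC ρ (set ℓ V M) = set ℓ (renV ρ V) (renC ρ M)

exts : (Var → Val) → Var → Val
exts σ zero = var zero
exts σ (suc n) = renV suc (σ n)

subV : (Var → Val) → Val → Val
subC : (Var → Val) → Comp → Comp
subV σ (var x) = σ x
subV σ (lam M) = lam (subC (exts σ) M)
subC σ (ret V) = ret (subV σ V)
subC σ (M ⋆ V) = subC σ M ⋆ subV σ V
subC σ (get ℓ M) = get ℓ (subC (exts σ) M)
subC σ (set ℓ V M) = set ℓ (subV σ V) (subC σ M)

sub1 : Val → Var → Val
sub1 V zero = V
sub1 V (suc n) = var n

-- M [ V ] is M[V/x] where x is the variable bound by the enclosing binder
_[_] : Comp → Val → Comp
M [ V ] = subC (sub1 V) M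

data Store : Set
data Lkp : Set
inDom : Loc → Store → Bool

data Store where
  emp : Store
  upd : Loc → Lkp → Store → Store

data Lkp where
  val : Val → Lkp
  lkp : (ℓ : Loc) (s : Store) → T (inDom ℓ s) → Lkp

inDom ℓ emp = false
inDom ℓ (upd ℓ' u s) = (ℓ ≡ᵇ ℓ') ∨ inDom ℓ s

data _≐ₗ_ : Lkp → Lkp → Set
data _≐ₛ_ : Store → Store → Set

data _≐ₗ_ where
  reflₗ  : ∀ {u} → u ≐ₗ u
  symₗ   : ∀ {u u'} → u ≐ₗ u' → u' ≐ₗ u
  transₗ : ∀ {u u' u''} → u ≐ₗ u' → u' ≐ₗ u'' → u ≐ₗ u''
  lkp-cong : ∀ {ℓ s s'} (p : T (inDom ℓ s)) (p' : T (inDom ℓ s')) →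
             s ≐ₛ s' → lkp ℓ s p ≐ₗ lkp ℓ s' p'
  ax-lkp-upd : ∀ {ℓ u s} (p : T (inDom ℓ (upd ℓ u s))) →
               lkp ℓ (upd ℓ u s) p ≐ₗ u
  ax-lkp-upd' : ∀ {ℓ ℓ' u s} (p : T (inDom ℓ (upd ℓ' u s))) (q : T (inDom ℓ s)) →
                ¬ (ℓ ≡ ℓ') → lkp ℓ (upd ℓ' u s) p ≐ₗ lkp ℓ s q

data _≐ₛ_ where
  reflₛ  : ∀ {s} → s ≐ₛ s
  symₛ   : ∀ {s s'} → s ≐ₛ s' → s' ≐ₛ s
  transₛ : ∀ {s s' s''} → s ≐ₛ s' → s' ≐ₛ s'' → s ≐ₛ s''
  upd-cong : ∀ {ℓ u u' s s'} → u ≐ₗ u' → s ≐ₛ s' → upd ℓ u s ≐ₛ upd ℓ u' s'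
  ax-upd-lkp : ∀ {ℓ s} (p : T (inDom ℓ s)) → upd ℓ (lkp ℓ s p) s ≐ₛ s
  ax-upd-upd : ∀ {ℓ U W s} →
               upd ℓ (val U) (upd ℓ (val W) s) ≐ₛ upd ℓ (val U) s
  ax-upd-comm : ∀ {ℓ ℓ' U W s} → ¬ (ℓ ≡ ℓ') →
                upd ℓ (val U) (upd ℓ' (val W) s) ≐ₛ upd ℓ' (val W) (upd ℓ (val U) s)

data Config : Set where
  ⟨_,_⟩ : Comp → Store → Config

data _⟶_ : Config → Config → Set where
  β-red : ∀ {V M s} → ⟨ ret V ⋆ lam M , s ⟩ ⟶ ⟨ M [ V ] , s ⟩
  ⋆-red : ∀ {M N V s t} → ⟨ M , s ⟩ ⟶ ⟨ N , t ⟩ → ⟨ M ⋆ V , s ⟩ ⟶ ⟨ N ⋆ V , t ⟩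
  get-red : ∀ {ℓ M V s} (p : T (inDom ℓ s)) → lkp ℓ s p ≐ₗ val V →
            ⟨ get ℓ M , s ⟩ ⟶ ⟨ M [ V ] , s ⟩
  set-red : ∀ {ℓ V M s} → ⟨ set ℓ V M , s ⟩ ⟶ ⟨ M , upd ℓ (val V) s ⟩

data VType : Set
data SType : Set
data CType : Set
data TType : Set

infixr 7 _⇒_ _↝_
infixl 8 _∧ᵈ_ _∧ˢ_ _∧ᶜ_ _∧ᵗ_

data VType where
  _⇒_ : VType → TType → VType
  _∧ᵈ_ : VType → VType → VType
  ωᵈ : VType

data SType where
  ⟪_∶_⟫ : Loc → VType → SType
  _∧ˢ_ : SType → SType → SType
  ωˢ : SType

data CType where
  _⊗_ : VType → SType → CType
  _∧ᶜ_ : CType → CType → CType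
  ωᶜ : CType

data TType where
  _↝_ : SType → CType → TType
  _∧ᵗ_ : TType → TType → TType
  ωᵗ : TType

data _∈domˢ_ : Loc → SType → Set where
  here  : ∀ {ℓ δ} → ℓ ∈domˢ ⟪ ℓ ∶ δ ⟫
  left  : ∀ {ℓ σ σ'} → ℓ ∈domˢ σ → ℓ ∈domˢ (σ ∧ˢ σ')
  right : ∀ {ℓ σ σ'} → ℓ ∈domˢ σ' → ℓ ∈domˢ (σ ∧ˢ σ')

data _≤ᵈ_ : VType → VType → Set
data _≤ˢ_ : SType → SType → Set
data _≤ᶜ_ : CType → CType → Set
data _≤ᵗ_ : TType → TType → Set

data _≤ᵈ_ where
  reflᵈ  : ∀ {a} → a ≤ᵈ a
  transᵈ : ∀ {a b c} → a ≤ᵈ b → b ≤ᵈ c → a ≤ᵈ c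
  ≤ωᵈ    : ∀ {a} → a ≤ᵈ ωᵈ
  ∧lᵈ    : ∀ {a b} → (a ∧ᵈ b) ≤ᵈ a
  ∧rᵈ    : ∀ {a b} → (a ∧ᵈ b) ≤ᵈ b
  dupᵈ   : ∀ {a} → a ≤ᵈ (a ∧ᵈ a)
  ∧monoᵈ : ∀ {a a' b b'} → a ≤ᵈ a' → b ≤ᵈ b' → (a ∧ᵈ b) ≤ᵈ (a' ∧ᵈ b')
  ωarrᵈ  : ωᵈ ≤ᵈ (ωᵈ ⇒ ωᵗ)
  ∧arrᵈ  : ∀ {δ τ τ'} → ((δ ⇒ τ) ∧ᵈ (δ ⇒ τ')) ≤ᵈ (δ ⇒ (τ ∧ᵗ τ'))
  arrᵈ   : ∀ {δ δ' τ τ'} → δ' ≤ᵈ δ → τ ≤ᵗ τ' → (δ ⇒ τ) ≤ᵈ (δ' ⇒ τ')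

data _≤ˢ_ where
  reflˢ  : ∀ {a} → a ≤ˢ a
  transˢ : ∀ {a b c} → a ≤ˢ b → b ≤ˢ c → a ≤ˢ c
  ≤ωˢ    : ∀ {a} → a ≤ˢ ωˢ
  ∧lˢ    : ∀ {a b} → (a ∧ˢ b) ≤ˢ a
  ∧rˢ    : ∀ {a b} → (a ∧ˢ b) ≤ˢ b
  dupˢ   : ∀ {a} → a ≤ˢ (a ∧ˢ a)
  ∧monoˢ : ∀ {a a' b b'} → a ≤ˢ a' → b ≤ˢ b' → (a ∧ˢ b) ≤ˢ (a' ∧ˢ b')
  ∧locˢ  : ∀ {ℓ δ δ'} → (⟪ ℓ ∶ δ ⟫ ∧ˢ ⟪ ℓ ∶ δ' ⟫) ≤ˢ ⟪ ℓ ∶ δ ∧ᵈ δ' ⟫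
  locˢ   : ∀ {ℓ δ δ'} → δ ≤ᵈ δ' → ⟪ ℓ ∶ δ ⟫ ≤ˢ ⟪ ℓ ∶ δ' ⟫

data _≤ᶜ_ where
  reflᶜ  : ∀ {a} → a ≤ᶜ a
  transᶜ : ∀ {a b c} → a ≤ᶜ b → b ≤ᶜ c → a ≤ᶜ c
  ≤ωᶜ    : ∀ {a} → a ≤ᶜ ωᶜ
  ∧lᶜ    : ∀ {a b} → (a ∧ᶜ b) ≤ᶜ a
  ∧rᶜ    : ∀ {a b} → (a ∧ᶜ b) ≤ᶜ b
  dupᶜ   : ∀ {a} → a ≤ᶜ (a ∧ᶜ a)
  ∧monoᶜ : ∀ {a a' b b'} → a ≤ᶜ a' → b ≤ᶜ b' → (a ∧ᶜ b) ≤ᶜ (a' ∧ᶜ b')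
  ωprodᶜ : ωᶜ ≤ᶜ (ωᵈ ⊗ ωˢ)
  ∧prodᶜ : ∀ {δ δ' σ σ'} → ((δ ⊗ σ) ∧ᶜ (δ' ⊗ σ')) ≤ᶜ ((δ ∧ᵈ δ') ⊗ (σ ∧ˢ σ'))
  prodᶜ  : ∀ {δ δ' σ σ'} → δ ≤ᵈ δ' → σ ≤ˢ σ' → (δ ⊗ σ) ≤ᶜ (δ' ⊗ σ')

data _≤ᵗ_ where
  reflᵗ  : ∀ {a} → a ≤ᵗ a
  transᵗ : ∀ {a b c} → a ≤ᵗ b → b ≤ᵗ c → a ≤ᵗ c
  ≤ωᵗ    : ∀ {a} → a ≤ᵗ ωᵗ
  ∧lᵗ    : ∀ {a b} → (a ∧ᵗ b) ≤ᵗ a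
  ∧rᵗ    : ∀ {a b} → (a ∧ᵗ b) ≤ᵗ b
  dupᵗ   : ∀ {a} → a ≤ᵗ (a ∧ᵗ a)
  ∧monoᵗ : ∀ {a a' b b'} → a ≤ᵗ a' → b ≤ᵗ b' → (a ∧ᵗ b) ≤ᵗ (a' ∧ᵗ b')
  ωarrᵗ  : ωᵗ ≤ᵗ (ωˢ ↝ ωᶜ)
  ∧arrᵗ  : ∀ {σ κ κ'} → ((σ ↝ κ) ∧ᵗ (σ ↝ κ')) ≤ᵗ (σ ↝ (κ ∧ᶜ κ'))
  arrᵗ   : ∀ {σ σ' κ κ'} → σ' ≤ˢ σ → κ ≤ᶜ κ' → (σ ↝ κ) ≤ᵗ (σ' ↝ κ')

-- Contexts: the type of de Bruijn variable i is the i-th entry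
-- (variables beyond the length of Γ are not in dom Γ).

Ctx : Set
Ctx = List VType

data _∋_∶_ : Ctx → Var → VType → Set where
  here  : ∀ {Γ δ} → (δ ∷ Γ) ∋ zero ∶ δ
  there : ∀ {Γ δ δ' x} → Γ ∋ x ∶ δ → (δ' ∷ Γ) ∋ suc x ∶ δ

data _⊢ᵛ_∶_ : Ctx → Val → VType → Set
data _⊢ᵐ_∶_ : Ctx → Comp → TType → Set
data _⊢ˢ_∶_ : Ctx → Store → SType → Set
data _⊢ˡ_∶_ : Ctx → Lkp → VType → Set

data _⊢ᵛ_∶_ where
  ωᵛ-I : ∀ {Γ V} → Γ ⊢ᵛ V ∶ ωᵈ
  ∧ᵛ-I : ∀ {Γ V δ δ'} → Γ ⊢ᵛ V ∶ δ → Γ ⊢ᵛ V ∶ δ' → Γ ⊢ᵛ V ∶ (δ ∧ᵈ δ')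
  ≤ᵛ   : ∀ {Γ V δ δ'} → Γ ⊢ᵛ V ∶ δ → δ ≤ᵈ δ' → Γ ⊢ᵛ V ∶ δ'
  varᵛ : ∀ {Γ x δ} → Γ ∋ x ∶ δ → Γ ⊢ᵛ var x ∶ δ
  lamᵛ : ∀ {Γ M δ τ} → (δ ∷ Γ) ⊢ᵐ M ∶ τ → Γ ⊢ᵛ lam M ∶ (δ ⇒ τ)

data _⊢ᵐ_∶_ where
  ωᵐ-I : ∀ {Γ M} → Γ ⊢ᵐ M ∶ ωᵗ
  ∧ᵐ-I : ∀ {Γ M τ τ'} → Γ ⊢ᵐ M ∶ τ → Γ ⊢ᵐ M ∶ τ' → Γ ⊢ᵐ M ∶ (τ ∧ᵗ τ')
  ≤ᵐ   : ∀ {Γ M τ τ'} → Γ ⊢ᵐ M ∶ τ → τ ≤ᵗ τ' → Γ ⊢ᵐ M ∶ τ'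
  retᵐ : ∀ {Γ V δ σ} → Γ ⊢ᵛ V ∶ δ → Γ ⊢ᵐ ret V ∶ (σ ↝ (δ ⊗ σ))
  bindᵐ : ∀ {Γ M V σ δ' σ' δ'' σ''} →
          Γ ⊢ᵐ M ∶ (σ ↝ (δ' ⊗ σ')) →
          Γ ⊢ᵛ V ∶ (δ' ⇒ (σ' ↝ (δ'' ⊗ σ''))) →
          Γ ⊢ᵐ (M ⋆ V) ∶ (σ ↝ (δ'' ⊗ σ''))
  getᵐ : ∀ {Γ ℓ M δ σ κ} → (δ ∷ Γ) ⊢ᵐ M ∶ (σ ↝ κ) →
         Γ ⊢ᵐ get ℓ M ∶ ((⟪ ℓ ∶ δ ⟫ ∧ˢ σ) ↝ κ)
  setᵐ : ∀ {Γ ℓ V M δ σ κ} → Γ ⊢ᵛ V ∶ δ →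
         Γ ⊢ᵐ M ∶ ((⟪ ℓ ∶ δ ⟫ ∧ˢ σ) ↝ κ) → ¬ (ℓ ∈domˢ σ) →
         Γ ⊢ᵐ set ℓ V M ∶ (σ ↝ κ)

data _⊢ˢ_∶_ where
  ωˢ-I : ∀ {Γ s} → Γ ⊢ˢ s ∶ ωˢ
  ∧ˢ-I : ∀ {Γ s σ σ'} → Γ ⊢ˢ s ∶ σ → Γ ⊢ˢ s ∶ σ' → Γ ⊢ˢ s ∶ (σ ∧ˢ σ')
  ≤ˢ-I : ∀ {Γ s σ σ'} → Γ ⊢ˢ s ∶ σ → σ ≤ˢ σ' → Γ ⊢ˢ s ∶ σ'
  upd-here  : ∀ {Γ ℓ V s δ} → Γ ⊢ᵛ V ∶ δ → Γ ⊢ˢ upd ℓ (val V) s ∶ ⟪ ℓ ∶ δ ⟫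
  upd-there : ∀ {Γ ℓ ℓ' V s δ} → Γ ⊢ˢ s ∶ ⟪ ℓ' ∶ δ ⟫ → ¬ (ℓ ≡ ℓ') →
              Γ ⊢ˢ upd ℓ (val V) s ∶ ⟪ ℓ' ∶ δ ⟫

data _⊢ˡ_∶_ where
  ωˡ-I : ∀ {Γ u} → Γ ⊢ˡ u ∶ ωᵈ
  ∧ˡ-I : ∀ {Γ u δ δ'} → Γ ⊢ˡ u ∶ δ → Γ ⊢ˡ u ∶ δ' → Γ ⊢ˡ u ∶ (δ ∧ᵈ δ')
  ≤ˡ   : ∀ {Γ u δ δ'} → Γ ⊢ˡ u ∶ δ → δ ≤ᵈ δ' → Γ ⊢ˡ u ∶ δ'
  valˡ : ∀ {Γ V δ} → Γ ⊢ᵛ V ∶ δ → Γ ⊢ˡ val V ∶ δ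
  lkpˡ : ∀ {Γ ℓ s δ} (p : T (inDom ℓ s)) → Γ ⊢ˢ s ∶ ⟪ ℓ ∶ δ ⟫ → Γ ⊢ˡ lkp ℓ s p ∶ δ

data _⊢ᶜ_∶_ : Ctx → Config → CType → Set where
  ωᶜ-I : ∀ {Γ c} → Γ ⊢ᶜ c ∶ ωᶜ
  ∧ᶜ-I : ∀ {Γ c κ κ'} → Γ ⊢ᶜ c ∶ κ → Γ ⊢ᶜ c ∶ κ' → Γ ⊢ᶜ c ∶ (κ ∧ᶜ κ')
  ≤ᶜ-I : ∀ {Γ c κ κ'} → Γ ⊢ᶜ c ∶ κ → κ ≤ᶜ κ' → Γ ⊢ᶜ c ∶ κ'
  confᶜ : ∀ {Γ M s σ κ} → Γ ⊢ᵐ M ∶ (σ ↝ κ) → Γ ⊢ˢ s ∶ σ → Γ ⊢ᶜ ⟨ M , s ⟩ ∶ κ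

{-# OPTIONS --safe #-}
-- Subject reduction is proved by induction on the typing of the computation,
-- against a reading of configuration types that is closed under subtyping and
-- intersection, so the structural typing rules need no separate treatment.
-- The two non-syntactic ingredients are inversion for λ and [V], each obtained
-- the same way (a type-indexed predicate closed under ≤), and the fact that a
-- get reads a value of the promised type.  For the latter, store terms are
-- interpreted as partial maps from locations to values: the store equations
-- are sound for this model, and a derivation of s : ⟨ℓ:δ⟩ guarantees that the
-- value at ℓ in the model has type δ.
module Submission where

open import Defs
open import Data.Nat using (suc; _≟_)
open import Data.Bool using (T)
open import Data.Maybe using (Maybe; just; nothing)
open import Data.Product using (Σ-syntax; _×_; _,_; proj₁; proj₂)
open import Data.Unit using (⊤; tt)
open import Data.Empty using (⊥-elim)
open import Data.List using (_∷_)
open import Relation.Nullary using (¬_; Dec; yes; no)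
open import Relation.Binary.PropositionalEquality using (_≡_; refl; sym; trans; cong₂)

-- Unlike if_then_else_ on does, this keeps the decision procedure visible to with.
if?_then_else_ : {P A : Set} → Dec P → A → A → A
if? yes _ then a else _ = a
if? no _ then _ else b = b

lookupˢ : Store → Loc → Maybe Val
evalˡ : Lkp → Maybe Val
lookupˢ emp ℓ = nothing
lookupˢ (upd ℓ' u s) ℓ = if? ℓ ≟ ℓ' then evalˡ u else lookupˢ s ℓ
evalˡ (val V) = just V
evalˡ (lkp ℓ s _) = lookupˢ s ℓ

≐ₗ-sound : ∀ {u u'} → u ≐ₗ u' → evalˡ u ≡ evalˡ u'
≐ₛ-sound : ∀ {s s'} → s ≐ₛ s' → ∀ ℓ → lookupˢ s ℓ ≡ lookupˢ s' ℓ
≐ₗ-sound reflₗ = refl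
≐ₗ-sound (symₗ e) = sym (≐ₗ-sound e)
≐ₗ-sound (transₗ e e') = trans (≐ₗ-sound e) (≐ₗ-sound e')
≐ₗ-sound (lkp-cong {ℓ} _ _ e) = ≐ₛ-sound e ℓ
≐ₗ-sound (ax-lkp-upd {ℓ} _) with ℓ ≟ ℓ
... | yes _ = refl
... | no ℓ≢ℓ = ⊥-elim (ℓ≢ℓ refl)
≐ₗ-sound (ax-lkp-upd' {ℓ} {ℓ'} _ _ ℓ≢ℓ') with ℓ ≟ ℓ'
... | yes ℓ≡ℓ' = ⊥-elim (ℓ≢ℓ' ℓ≡ℓ')
... | no _ = refl
≐ₛ-sound reflₛ ℓ = refl
≐ₛ-sound (symₛ e) ℓ = sym (≐ₛ-sound e ℓ)
≐ₛ-sound (transₛ e e') ℓ = trans (≐ₛ-sound e ℓ) (≐ₛ-sound e' ℓ)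
≐ₛ-sound (upd-cong {ℓ'} eu es) ℓ =
  cong₂ (if? ℓ ≟ ℓ' then_else_) (≐ₗ-sound eu) (≐ₛ-sound es ℓ)
≐ₛ-sound (ax-upd-lkp {ℓ'} _) ℓ with ℓ ≟ ℓ'
... | yes refl = refl
... | no _ = refl
≐ₛ-sound (ax-upd-upd {ℓ'}) ℓ with ℓ ≟ ℓ'
... | yes _ = refl
... | no _ = refl
≐ₛ-sound (ax-upd-comm {ℓ₁} {ℓ₂} ℓ₁≢ℓ₂) ℓ with ℓ ≟ ℓ₁ | ℓ ≟ ℓ₂
... | yes ℓ≡ℓ₁ | yes ℓ≡ℓ₂ = ⊥-elim (ℓ₁≢ℓ₂ (trans (sym ℓ≡ℓ₁) ℓ≡ℓ₂))
... | yes _ | no _ = refl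
... | no _ | yes _ = refl
... | no _ | no _ = refl

_⊨ˢ_∶_ : Ctx → Store → SType → Set
Γ ⊨ˢ s ∶ ⟪ ℓ ∶ δ ⟫ = ∀ V → lookupˢ s ℓ ≡ just V → Γ ⊢ᵛ V ∶ δ
Γ ⊨ˢ s ∶ (σ ∧ˢ σ') = Γ ⊨ˢ s ∶ σ × Γ ⊨ˢ s ∶ σ'
Γ ⊨ˢ s ∶ ωˢ = ⊤

⊨ˢ-mono : ∀ {Γ s σ σ'} → σ ≤ˢ σ' → Γ ⊨ˢ s ∶ σ → Γ ⊨ˢ s ∶ σ'
⊨ˢ-mono reflˢ x = x
⊨ˢ-mono (transˢ p q) x = ⊨ˢ-mono q (⊨ˢ-mono p x)
⊨ˢ-mono ≤ωˢ _ = tt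
⊨ˢ-mono ∧lˢ x = proj₁ x
⊨ˢ-mono ∧rˢ x = proj₂ x
⊨ˢ-mono dupˢ x = x , x
⊨ˢ-mono (∧monoˢ p q) (a , b) = ⊨ˢ-mono p a , ⊨ˢ-mono q b
⊨ˢ-mono ∧locˢ (f , g) V e = ∧ᵛ-I (f V e) (g V e)
⊨ˢ-mono (locˢ δ≤δ') f V e = ≤ᵛ (f V e) δ≤δ'

⊢ˢ⇒⊨ˢ : ∀ {Γ s σ} → Γ ⊢ˢ s ∶ σ → Γ ⊨ˢ s ∶ σ
⊢ˢ⇒⊨ˢ ωˢ-I = tt
⊢ˢ⇒⊨ˢ (∧ˢ-I a b) = ⊢ˢ⇒⊨ˢ a , ⊢ˢ⇒⊨ˢ b
⊢ˢ⇒⊨ˢ (≤ˢ-I a σ≤σ') = ⊨ˢ-mono σ≤σ' (⊢ˢ⇒⊨ˢ a)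
⊢ˢ⇒⊨ˢ (upd-here {ℓ = ℓ} ⊢V) V' e with ℓ ≟ ℓ
⊢ˢ⇒⊨ˢ (upd-here ⊢V) V' refl | yes _ = ⊢V
... | no ℓ≢ℓ = ⊥-elim (ℓ≢ℓ refl)
⊢ˢ⇒⊨ˢ (upd-there {ℓ = ℓ} {ℓ'} ⊢s ℓ≢ℓ') V' e with ℓ' ≟ ℓ
... | yes ℓ'≡ℓ = ⊥-elim (ℓ≢ℓ' (sym ℓ'≡ℓ))
... | no _ = ⊢ˢ⇒⊨ˢ ⊢s V' e

lkp-typing : ∀ {Γ ℓ s δ V} (p : T (inDom ℓ s)) →
             Γ ⊢ˢ s ∶ ⟪ ℓ ∶ δ ⟫ → lkp ℓ s p ≐ₗ val V → Γ ⊢ᵛ V ∶ δ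
lkp-typing {V = V} _ ⊢s e = ⊢ˢ⇒⊨ˢ ⊢s V (≐ₗ-sound e)

upd-typing-∉dom : ∀ {Γ ℓ V s σ} → ¬ (ℓ ∈domˢ σ) → Γ ⊢ˢ s ∶ σ →
                  Γ ⊢ˢ upd ℓ (val V) s ∶ σ
upd-typing-∉dom {σ = ⟪ _ ∶ _ ⟫} ℓ∉σ ⊢s = upd-there ⊢s (λ { refl → ℓ∉σ here })
upd-typing-∉dom {σ = _ ∧ˢ _} ℓ∉σ ⊢s =
  ∧ˢ-I (upd-typing-∉dom (λ z → ℓ∉σ (left z)) (≤ˢ-I ⊢s ∧lˢ))
       (upd-typing-∉dom (λ z → ℓ∉σ (right z)) (≤ˢ-I ⊢s ∧rˢ))
upd-typing-∉dom {σ = ωˢ} _ _ = ωˢ-I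

Renaming : Ctx → Ctx → (Var → Var) → Set
Renaming Γ Δ ρ = ∀ {x δ} → Γ ∋ x ∶ δ → Δ ∋ ρ x ∶ δ

ext-Renaming : ∀ {Γ Δ ρ δ} → Renaming Γ Δ ρ → Renaming (δ ∷ Γ) (δ ∷ Δ) (ext ρ)
ext-Renaming r here = here
ext-Renaming r (there x) = there (r x)

renameᵛ : ∀ {Γ Δ ρ V δ} → Renaming Γ Δ ρ → Γ ⊢ᵛ V ∶ δ → Δ ⊢ᵛ renV ρ V ∶ δ
renameᵐ : ∀ {Γ Δ ρ M τ} → Renaming Γ Δ ρ → Γ ⊢ᵐ M ∶ τ → Δ ⊢ᵐ renC ρ M ∶ τ
renameᵛ r ωᵛ-I = ωᵛ-I
renameᵛ r (∧ᵛ-I a b) = ∧ᵛ-I (renameᵛ r a) (renameᵛ r b)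
renameᵛ r (≤ᵛ a le) = ≤ᵛ (renameᵛ r a) le
renameᵛ r (varᵛ x) = varᵛ (r x)
renameᵛ r (lamᵛ d) = lamᵛ (renameᵐ (ext-Renaming r) d)
renameᵐ r ωᵐ-I = ωᵐ-I
renameᵐ r (∧ᵐ-I a b) = ∧ᵐ-I (renameᵐ r a) (renameᵐ r b)
renameᵐ r (≤ᵐ a le) = ≤ᵐ (renameᵐ r a) le
renameᵐ r (retᵐ ⊢V) = retᵐ (renameᵛ r ⊢V)
renameᵐ r (bindᵐ ⊢M ⊢V) = bindᵐ (renameᵐ r ⊢M) (renameᵛ r ⊢V)
renameᵐ r (getᵐ d) = getᵐ (renameᵐ (ext-Renaming r) d)
renameᵐ r (setᵐ ⊢V ⊢M ℓ∉σ) = setᵐ (renameᵛ r ⊢V) (renameᵐ r ⊢M) ℓ∉σ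

Substitution : Ctx → Ctx → (Var → Val) → Set
Substitution Γ Δ θ = ∀ {x δ} → Γ ∋ x ∶ δ → Δ ⊢ᵛ θ x ∶ δ

exts-Substitution : ∀ {Γ Δ θ δ} → Substitution Γ Δ θ →
                    Substitution (δ ∷ Γ) (δ ∷ Δ) (exts θ)
exts-Substitution r here = varᵛ here
exts-Substitution r (there x) = renameᵛ there (r x)

substituteᵛ : ∀ {Γ Δ θ V δ} → Substitution Γ Δ θ → Γ ⊢ᵛ V ∶ δ → Δ ⊢ᵛ subV θ V ∶ δ
substituteᵐ : ∀ {Γ Δ θ M τ} → Substitution Γ Δ θ → Γ ⊢ᵐ M ∶ τ → Δ ⊢ᵐ subC θ M ∶ τ
substituteᵛ r ωᵛ-I = ωᵛ-I
substituteᵛ r (∧ᵛ-I a b) = ∧ᵛ-I (substituteᵛ r a) (substituteᵛ r b)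
substituteᵛ r (≤ᵛ a le) = ≤ᵛ (substituteᵛ r a) le
substituteᵛ r (varᵛ x) = r x
substituteᵛ r (lamᵛ d) = lamᵛ (substituteᵐ (exts-Substitution r) d)
substituteᵐ r ωᵐ-I = ωᵐ-I
substituteᵐ r (∧ᵐ-I a b) = ∧ᵐ-I (substituteᵐ r a) (substituteᵐ r b)
substituteᵐ r (≤ᵐ a le) = ≤ᵐ (substituteᵐ r a) le
substituteᵐ r (retᵐ ⊢V) = retᵐ (substituteᵛ r ⊢V)
substituteᵐ r (bindᵐ ⊢M ⊢V) = bindᵐ (substituteᵐ r ⊢M) (substituteᵛ r ⊢V)
substituteᵐ r (getᵐ d) = getᵐ (substituteᵐ (exts-Substitution r) d)
substituteᵐ r (setᵐ ⊢V ⊢M ℓ∉σ) = setᵐ (substituteᵛ r ⊢V) (substituteᵐ r ⊢M) ℓ∉σ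

sub1-Substitution : ∀ {Γ W δ} → Γ ⊢ᵛ W ∶ δ → Substitution (δ ∷ Γ) Γ (sub1 W)
sub1-Substitution ⊢W here = ⊢W
sub1-Substitution ⊢W (there x) = varᵛ x

[]-typing : ∀ {Γ M W δ τ} → (δ ∷ Γ) ⊢ᵐ M ∶ τ → Γ ⊢ᵛ W ∶ δ → Γ ⊢ᵐ M [ W ] ∶ τ
[]-typing ⊢M ⊢W = substituteᵐ (sub1-Substitution ⊢W) ⊢M

Narrowing : Ctx → Ctx → Set
Narrowing Γ Δ = ∀ {x δ} → Γ ∋ x ∶ δ → Δ ⊢ᵛ var x ∶ δ

var-weaken : ∀ {Δ y δ δ'} → Δ ⊢ᵛ var y ∶ δ → (δ' ∷ Δ) ⊢ᵛ var (suc y) ∶ δ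
var-weaken ωᵛ-I = ωᵛ-I
var-weaken (∧ᵛ-I a b) = ∧ᵛ-I (var-weaken a) (var-weaken b)
var-weaken (≤ᵛ a le) = ≤ᵛ (var-weaken a) le
var-weaken (varᵛ x) = varᵛ (there x)

ext-Narrowing : ∀ {Γ Δ δ} → Narrowing Γ Δ → Narrowing (δ ∷ Γ) (δ ∷ Δ)
ext-Narrowing n here = varᵛ here
ext-Narrowing n (there x) = var-weaken (n x)

narrowᵛ : ∀ {Γ Δ V δ} → Narrowing Γ Δ → Γ ⊢ᵛ V ∶ δ → Δ ⊢ᵛ V ∶ δ
narrowᵐ : ∀ {Γ Δ M τ} → Narrowing Γ Δ → Γ ⊢ᵐ M ∶ τ → Δ ⊢ᵐ M ∶ τ
narrowᵛ n ωᵛ-I = ωᵛ-I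
narrowᵛ n (∧ᵛ-I a b) = ∧ᵛ-I (narrowᵛ n a) (narrowᵛ n b)
narrowᵛ n (≤ᵛ a le) = ≤ᵛ (narrowᵛ n a) le
narrowᵛ n (varᵛ x) = n x
narrowᵛ n (lamᵛ d) = lamᵛ (narrowᵐ (ext-Narrowing n) d)
narrowᵐ n ωᵐ-I = ωᵐ-I
narrowᵐ n (∧ᵐ-I a b) = ∧ᵐ-I (narrowᵐ n a) (narrowᵐ n b)
narrowᵐ n (≤ᵐ a le) = ≤ᵐ (narrowᵐ n a) le
narrowᵐ n (retᵐ ⊢V) = retᵐ (narrowᵛ n ⊢V)
narrowᵐ n (bindᵐ ⊢M ⊢V) = bindᵐ (narrowᵐ n ⊢M) (narrowᵛ n ⊢V)
narrowᵐ n (getᵐ d) = getᵐ (narrowᵐ (ext-Narrowing n) d)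
narrowᵐ n (setᵐ ⊢V ⊢M ℓ∉σ) = setᵐ (narrowᵛ n ⊢V) (narrowᵐ n ⊢M) ℓ∉σ

narrow-head : ∀ {Γ δ δ'} → δ' ≤ᵈ δ → Narrowing (δ ∷ Γ) (δ' ∷ Γ)
narrow-head δ'≤δ here = ≤ᵛ (varᵛ here) δ'≤δ
narrow-head δ'≤δ (there x) = varᵛ (there x)

LamBody : Ctx → Comp → VType → Set
LamBody Γ M (δ ⇒ τ) = (δ ∷ Γ) ⊢ᵐ M ∶ τ
LamBody Γ M (δ ∧ᵈ δ') = LamBody Γ M δ × LamBody Γ M δ'
LamBody Γ M ωᵈ = ⊤

LamBody-mono : ∀ {Γ M δ δ'} → δ ≤ᵈ δ' → LamBody Γ M δ → LamBody Γ M δ'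
LamBody-mono reflᵈ x = x
LamBody-mono (transᵈ p q) x = LamBody-mono q (LamBody-mono p x)
LamBody-mono ≤ωᵈ _ = tt
LamBody-mono ∧lᵈ x = proj₁ x
LamBody-mono ∧rᵈ x = proj₂ x
LamBody-mono dupᵈ x = x , x
LamBody-mono (∧monoᵈ p q) (a , b) = LamBody-mono p a , LamBody-mono q b
LamBody-mono ωarrᵈ _ = ωᵐ-I
LamBody-mono ∧arrᵈ (a , b) = ∧ᵐ-I a b
LamBody-mono (arrᵈ δ'≤δ τ≤τ') ⊢M = ≤ᵐ (narrowᵐ (narrow-head δ'≤δ) ⊢M) τ≤τ'

lam-inversion : ∀ {Γ M δ} → Γ ⊢ᵛ lam M ∶ δ → LamBody Γ M δ
lam-inversion ωᵛ-I = tt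
lam-inversion (∧ᵛ-I a b) = lam-inversion a , lam-inversion b
lam-inversion (≤ᵛ a le) = LamBody-mono le (lam-inversion a)
lam-inversion (lamᵛ ⊢M) = ⊢M

ReturnsFrom : Ctx → Val → SType → CType → Set
ReturnsFrom Γ W σ (δ ⊗ σ') = Γ ⊢ᵛ W ∶ δ × σ ≤ˢ σ'
ReturnsFrom Γ W σ (κ ∧ᶜ κ') = ReturnsFrom Γ W σ κ × ReturnsFrom Γ W σ κ'
ReturnsFrom Γ W σ ωᶜ = ⊤

ReturnsFrom-mono : ∀ {Γ W σ κ κ'} → κ ≤ᶜ κ' → ReturnsFrom Γ W σ κ → ReturnsFrom Γ W σ κ'
ReturnsFrom-mono reflᶜ x = x
ReturnsFrom-mono (transᶜ p q) x = ReturnsFrom-mono q (ReturnsFrom-mono p x)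
ReturnsFrom-mono ≤ωᶜ _ = tt
ReturnsFrom-mono ∧lᶜ x = proj₁ x
ReturnsFrom-mono ∧rᶜ x = proj₂ x
ReturnsFrom-mono dupᶜ x = x , x
ReturnsFrom-mono (∧monoᶜ p q) (a , b) = ReturnsFrom-mono p a , ReturnsFrom-mono q b
ReturnsFrom-mono ωprodᶜ _ = ωᵛ-I , ≤ωˢ
ReturnsFrom-mono ∧prodᶜ ((a , p) , (b , q)) = ∧ᵛ-I a b , transˢ dupˢ (∧monoˢ p q)
ReturnsFrom-mono (prodᶜ δ≤δ' σ≤σ') (a , r) = ≤ᵛ a δ≤δ' , transˢ r σ≤σ'

ReturnsFrom-antitone : ∀ {Γ W σ σ' κ} → σ' ≤ˢ σ → ReturnsFrom Γ W σ κ → ReturnsFrom Γ W σ' κ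
ReturnsFrom-antitone {κ = _ ⊗ _} σ'≤σ (a , r) = a , transˢ σ'≤σ r
ReturnsFrom-antitone {κ = _ ∧ᶜ _} σ'≤σ (a , b) =
  ReturnsFrom-antitone σ'≤σ a , ReturnsFrom-antitone σ'≤σ b
ReturnsFrom-antitone {κ = ωᶜ} _ _ = tt

Returns : Ctx → Val → TType → Set
Returns Γ W (σ ↝ κ) = ReturnsFrom Γ W σ κ
Returns Γ W (τ ∧ᵗ τ') = Returns Γ W τ × Returns Γ W τ'
Returns Γ W ωᵗ = ⊤

Returns-mono : ∀ {Γ W τ τ'} → τ ≤ᵗ τ' → Returns Γ W τ → Returns Γ W τ'
Returns-mono reflᵗ x = x
Returns-mono (transᵗ p q) x = Returns-mono q (Returns-mono p x)
Returns-mono ≤ωᵗ _ = tt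
Returns-mono ∧lᵗ x = proj₁ x
Returns-mono ∧rᵗ x = proj₂ x
Returns-mono dupᵗ x = x , x
Returns-mono (∧monoᵗ p q) (a , b) = Returns-mono p a , Returns-mono q b
Returns-mono ωarrᵗ _ = tt
Returns-mono ∧arrᵗ x = x
Returns-mono (arrᵗ σ'≤σ κ≤κ') x = ReturnsFrom-mono κ≤κ' (ReturnsFrom-antitone σ'≤σ x)

ret-inversion : ∀ {Γ W τ} → Γ ⊢ᵐ ret W ∶ τ → Returns Γ W τ
ret-inversion ωᵐ-I = tt
ret-inversion (∧ᵐ-I a b) = ret-inversion a , ret-inversion b
ret-inversion (≤ᵐ a le) = Returns-mono le (ret-inversion a)
ret-inversion (retᵐ ⊢W) = ⊢W , reflˢ

conf-inversion : ∀ {Γ N t κ} → Γ ⊢ᶜ ⟨ N , t ⟩ ∶ κ →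
                 Σ[ σ ∈ SType ] Γ ⊢ᵐ N ∶ (σ ↝ κ) × Γ ⊢ˢ t ∶ σ
conf-inversion ωᶜ-I = ωˢ , ≤ᵐ ωᵐ-I ωarrᵗ , ωˢ-I
conf-inversion (∧ᶜ-I a b) with conf-inversion a | conf-inversion b
... | σ , ⊢N , ⊢t | σ' , ⊢N' , ⊢t' =
  σ ∧ˢ σ' ,
  ≤ᵐ (∧ᵐ-I (≤ᵐ ⊢N (arrᵗ ∧lˢ reflᶜ)) (≤ᵐ ⊢N' (arrᵗ ∧rˢ reflᶜ))) ∧arrᵗ ,
  ∧ˢ-I ⊢t ⊢t'
conf-inversion (≤ᶜ-I a κ≤κ') with conf-inversion a
... | σ , ⊢N , ⊢t = σ , ≤ᵐ ⊢N (arrᵗ reflˢ κ≤κ') , ⊢t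
conf-inversion (confᶜ ⊢N ⊢t) = _ , ⊢N , ⊢t

ReductTyped : Ctx → Store → Comp → Store → TType → Set
ReductTyped Γ s N t (σ ↝ κ) = Γ ⊢ˢ s ∶ σ → Γ ⊢ᶜ ⟨ N , t ⟩ ∶ κ
ReductTyped Γ s N t (τ ∧ᵗ τ') = ReductTyped Γ s N t τ × ReductTyped Γ s N t τ'
ReductTyped Γ s N t ωᵗ = ⊤

ReductTyped-mono : ∀ {Γ s N t τ τ'} → τ ≤ᵗ τ' →
                   ReductTyped Γ s N t τ → ReductTyped Γ s N t τ'
ReductTyped-mono reflᵗ x = x
ReductTyped-mono (transᵗ p q) x = ReductTyped-mono q (ReductTyped-mono p x)
ReductTyped-mono ≤ωᵗ _ = tt
ReductTyped-mono ∧lᵗ x = proj₁ x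
ReductTyped-mono ∧rᵗ x = proj₂ x
ReductTyped-mono dupᵗ x = x , x
ReductTyped-mono (∧monoᵗ p q) (a , b) = ReductTyped-mono p a , ReductTyped-mono q b
ReductTyped-mono ωarrᵗ _ _ = ωᶜ-I
ReductTyped-mono ∧arrᵗ (f , g) ⊢s = ∧ᶜ-I (f ⊢s) (g ⊢s)
ReductTyped-mono (arrᵗ σ'≤σ κ≤κ') f ⊢s = ≤ᶜ-I (f (≤ˢ-I ⊢s σ'≤σ)) κ≤κ'

⊢ᵐ-preservation : ∀ {Γ M τ s N t} → Γ ⊢ᵐ M ∶ τ → ⟨ M , s ⟩ ⟶ ⟨ N , t ⟩ →
                  ReductTyped Γ s N t τ
⊢ᵐ-preservation ωᵐ-I _ = tt
⊢ᵐ-preservation (∧ᵐ-I a b) r = ⊢ᵐ-preservation a r , ⊢ᵐ-preservation b r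
⊢ᵐ-preservation (≤ᵐ a le) r = ReductTyped-mono le (⊢ᵐ-preservation a r)
⊢ᵐ-preservation (retᵐ _) ()
⊢ᵐ-preservation (bindᵐ ⊢M ⊢V) β-red ⊢s with ret-inversion ⊢M
... | ⊢W , σ≤σ' = confᶜ ([]-typing (lam-inversion ⊢V) ⊢W) (≤ˢ-I ⊢s σ≤σ')
⊢ᵐ-preservation (bindᵐ ⊢M ⊢V) (⋆-red r) ⊢s with conf-inversion (⊢ᵐ-preservation ⊢M r ⊢s)
... | _ , ⊢N , ⊢t = confᶜ (bindᵐ ⊢N ⊢V) ⊢t
⊢ᵐ-preservation (getᵐ ⊢M) (get-red p e) ⊢s =
  confᶜ ([]-typing ⊢M (lkp-typing p (≤ˢ-I ⊢s ∧lˢ) e)) (≤ˢ-I ⊢s ∧rˢ)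
⊢ᵐ-preservation (setᵐ ⊢V ⊢M ℓ∉σ) set-red ⊢s =
  confᶜ ⊢M (∧ˢ-I (upd-here ⊢V) (upd-typing-∉dom ℓ∉σ ⊢s))

mainTheorem2 : (Γ : Ctx) (M N : Comp) (s t : Store) (κ : CType) →
    Γ ⊢ᶜ ⟨ M , s ⟩ ∶ κ → ⟨ M , s ⟩ ⟶ ⟨ N , t ⟩ → Γ ⊢ᶜ ⟨ N , t ⟩ ∶ κ
mainTheorem2 Γ M N s t .ωᶜ ωᶜ-I r = ωᶜ-I
mainTheorem2 Γ M N s t (κ ∧ᶜ κ') (∧ᶜ-I a b) r =
  ∧ᶜ-I (mainTheorem2 Γ M N s t κ a r) (mainTheorem2 Γ M N s t κ' b r)
mainTheorem2 Γ M N s t κ (≤ᶜ-I a κ₀≤κ) r = ≤ᶜ-I (mainTheorem2 Γ M N s t _ a r) κ₀≤κ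
mainTheorem2 Γ M N s t κ (confᶜ ⊢M ⊢s) r = ⊢ᵐ-preservation ⊢M r ⊢s
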